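{- Let $\mathbf B$ be a Boolean-pointed Brouwerian algebra with constant $0$, write $\neg a:=a\to 0$, and define $a+b:=(0\to(a\wedge b))\wedge(a\vee b)$. Then for all $a,b\in B$, $a+b=(\neg a\to b)\wedge(\neg b\to a)$.
   Context: A Brouwerian algebra is a distributive lattice with top element $1$ equipped with a binary operation $\to$ of relative pseudocomplementation: $c\le a\to b\iff c\wedge a\le b$. It is Boolean-pointed if it has a constant $0$ such that the interval $[0,1]$ is a Boolean lattice (equivalently, $\neg\neg x=x\vee 0$ for all $x$, where $\neg x=x\to 0$). -}

module Defs where

open import Level using (Level; suc; _⊔_)
open import Data.Product using (Σ; _×_)
open import Function.Bundles using (_⇔_)
open import Algebra.Lattice.Bundles using (DistributiveLattice)

record BrouwerianAlgebra (c ℓ : Level) : Set (suc (c ⊔ ℓ)) where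
  field
    distributiveLattice : DistributiveLattice c ℓ
  open DistributiveLattice distributiveLattice public

  infix 4 _≤_
  _≤_ : Carrier → Carrier → Set ℓ
  x ≤ y = (x ∧ y) ≈ x

  infixr 5 _⇒_
  field
    _⇒_ : Carrier → Carrier → Carrier
    ⇒-cong : ∀ {a a′ b b′} → a ≈ a′ → b ≈ b′ → (a ⇒ b) ≈ (a′ ⇒ b′)
    𝟏 : Carrier
    𝟏-top : ∀ x → x ≤ 𝟏
    residuation : ∀ a b c → (c ≤ (a ⇒ b)) ⇔ ((c ∧ a) ≤ b)

-- Boolean-pointed: a constant 𝟎 such that the interval [𝟎, 𝟏] is a Boolean
-- lattice, i.e. (being a bounded distributive sublattice with bounds 𝟎, 𝟏)
-- every element of [𝟎, 𝟏] has a complement in [𝟎, 𝟏].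
record BooleanPointedBrouwerianAlgebra (c ℓ : Level) : Set (suc (c ⊔ ℓ)) where
  field
    brouwerianAlgebra : BrouwerianAlgebra c ℓ
  open BrouwerianAlgebra brouwerianAlgebra public
  field
    𝟎 : Carrier
    interval-complemented : ∀ x → 𝟎 ≤ x →
      Σ Carrier (λ y → (𝟎 ≤ y) × ((x ∧ y) ≈ 𝟎) × ((x ∨ y) ≈ 𝟏))

  ¬_ : Carrier → Carrier
  ¬ a = a ⇒ 𝟎

  infixl 6 _⊕_
  _⊕_ : Carrier → Carrier → Carrier
  a ⊕ b = (𝟎 ⇒ (a ∧ b)) ∧ (a ∨ b)

{-# OPTIONS --safe #-}

-- In a Boolean-pointed Brouwerian algebra the complement of a ∨ 𝟎 in [𝟎, 𝟏]
-- lies below ¬ a, so a ∨ ¬ a ≈ 𝟏 and hence ¬ a ⇒ b ≤ a ∨ b.  Together with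
-- (¬ a ⇒ b) ∧ 𝟎 ≤ b (as 𝟎 ≤ ¬ a) this gives (¬ a ⇒ b) ∧ (¬ b ⇒ a) ≤ a ⊕ b.
-- Conversely (a ∨ b) ∧ ¬ a ≤ 𝟎 ∨ b, and the factor 𝟎 ⇒ (a ∧ b) sends the
-- 𝟎 part below b, so a ⊕ b ≤ ¬ a ⇒ b, and symmetrically a ⊕ b ≤ ¬ b ⇒ a.
module Submission where

open import Defs
open import Level using (Level)
open import Data.Product using (_,_)
open import Function.Bundles using (Equivalence)
open import Relation.Binary.Bundles using (Poset)
open import Relation.Binary.Lattice.Bundles using (Lattice)
import Algebra.Lattice.Properties.Lattice as AlgebraicLatticeProperties
import Relation.Binary.Lattice.Properties.MeetSemilattice as MeetSemilatticeProperties
import Relation.Binary.Lattice.Properties.JoinSemilattice as JoinSemilatticeProperties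
import Relation.Binary.Reasoning.PartialOrder as PosetReasoning

-- The order of Defs is x ∧ y ≈ x; the library's natural order is its
-- symmetric variant x ≈ x ∧ y, which we work with throughout.
module BrouwerianAlgebraProperties {c ℓ : Level} (B : BrouwerianAlgebra c ℓ) where
  open BrouwerianAlgebra B hiding (_≤_)

  orderLattice : Lattice c ℓ ℓ
  orderLattice = AlgebraicLatticeProperties.∨-∧-orderTheoreticLattice lattice

  open Lattice orderLattice public
    using (_≤_; poset; x∧y≤x; x∧y≤y; ∧-greatest; x≤x∨y; y≤x∨y; ∨-least)
  open Poset poset public
    using ()
    renaming (refl to ≤-refl; reflexive to ≤-reflexive; trans to ≤-trans; antisym to ≤-antisym)
  open MeetSemilatticeProperties (Lattice.meetSemilattice orderLattice) public
    using (∧-monotonic)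
  open JoinSemilatticeProperties (Lattice.joinSemilattice orderLattice) public
    using (∨-monotonic)

  x≤𝟏 : ∀ {x} → x ≤ 𝟏
  x≤𝟏 {x} = sym (𝟏-top x)

  transpose-⇒ : ∀ {w x y} → w ∧ x ≤ y → w ≤ x ⇒ y
  transpose-⇒ {w} {x} {y} w∧x≤y = sym (Equivalence.from (residuation x y w) (sym w∧x≤y))

  transpose-∧ : ∀ {w x y} → w ≤ x ⇒ y → w ∧ x ≤ y
  transpose-∧ {w} {x} {y} w≤x⇒y = sym (Equivalence.to (residuation x y w) (sym w≤x⇒y))

  ⇒-eval : ∀ {x y} → (x ⇒ y) ∧ x ≤ y
  ⇒-eval = transpose-∧ ≤-refl

  ⇒-applyˡ : ∀ {w x y} → w ≤ x → (x ⇒ y) ∧ w ≤ y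
  ⇒-applyˡ w≤x = ≤-trans (∧-monotonic ≤-refl w≤x) ⇒-eval

  y≤x⇒y : ∀ {x y} → y ≤ x ⇒ y
  y≤x⇒y {x} {y} = transpose-⇒ (x∧y≤x y x)

module BooleanPointedBrouwerianAlgebraProperties
  {c ℓ : Level} (B : BooleanPointedBrouwerianAlgebra c ℓ) where
  open BooleanPointedBrouwerianAlgebra B hiding (_≤_)
  open BrouwerianAlgebraProperties brouwerianAlgebra public
  open PosetReasoning poset

  𝟎≤¬x : ∀ {x} → 𝟎 ≤ ¬ x
  𝟎≤¬x = y≤x⇒y

  x∧¬x≤𝟎 : ∀ {x} → x ∧ ¬ x ≤ 𝟎
  x∧¬x≤𝟎 {x} = ≤-trans (≤-reflexive (∧-comm x (¬ x))) ⇒-eval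

  𝟏≤x∨¬x : ∀ {x} → 𝟏 ≤ x ∨ ¬ x
  𝟏≤x∨¬x {x} with interval-complemented (x ∨ 𝟎) (sym (y≤x∨y x 𝟎))
  ... | y , _ , x∨𝟎∧y≈𝟎 , x∨𝟎∨y≈𝟏 = begin
    𝟏            ≈⟨ sym x∨𝟎∨y≈𝟏 ⟩
    (x ∨ 𝟎) ∨ y  ≤⟨ ∨-least (∨-monotonic ≤-refl 𝟎≤¬x) (≤-trans y≤¬x (y≤x∨y x (¬ x))) ⟩
    x ∨ ¬ x      ∎
    where
    y≤¬x : y ≤ ¬ x
    y≤¬x = transpose-⇒ (begin
      y ∧ x          ≤⟨ ∧-monotonic ≤-refl (x≤x∨y x 𝟎) ⟩
      y ∧ (x ∨ 𝟎)    ≈⟨ ∧-comm y (x ∨ 𝟎) ⟩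
      (x ∨ 𝟎) ∧ y    ≈⟨ x∨𝟎∧y≈𝟎 ⟩
      𝟎              ∎)

  ¬⇒≤∨ : ∀ {a b} → ¬ a ⇒ b ≤ a ∨ b
  ¬⇒≤∨ {a} {b} = begin
    ¬ a ⇒ b                                ≤⟨ ∧-greatest ≤-refl (≤-trans x≤𝟏 𝟏≤x∨¬x) ⟩
    (¬ a ⇒ b) ∧ (a ∨ ¬ a)                  ≈⟨ ∧-distribˡ-∨ (¬ a ⇒ b) a (¬ a) ⟩
    ((¬ a ⇒ b) ∧ a) ∨ ((¬ a ⇒ b) ∧ ¬ a)    ≤⟨ ∨-monotonic (x∧y≤y (¬ a ⇒ b) a) ⇒-eval ⟩
    a ∨ b                                  ∎

  ¬⇒∧𝟎≤ : ∀ {a b} → (¬ a ⇒ b) ∧ 𝟎 ≤ b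
  ¬⇒∧𝟎≤ = ⇒-applyˡ 𝟎≤¬x

  ⊕-comm : ∀ a b → a ⊕ b ≈ b ⊕ a
  ⊕-comm a b = ∧-cong (⇒-cong refl (∧-comm a b)) (∨-comm a b)

  ⊕≤¬⇒ : ∀ a b → a ⊕ b ≤ ¬ a ⇒ b
  ⊕≤¬⇒ a b = transpose-⇒ (begin
    (p ∧ (a ∨ b)) ∧ ¬ a            ≈⟨ ∧-assoc p (a ∨ b) (¬ a) ⟩
    p ∧ ((a ∨ b) ∧ ¬ a)            ≈⟨ ∧-cong refl (∧-distribʳ-∨ (¬ a) a b) ⟩
    p ∧ ((a ∧ ¬ a) ∨ (b ∧ ¬ a))    ≤⟨ ∧-monotonic ≤-refl (∨-monotonic x∧¬x≤𝟎 (x∧y≤x b (¬ a))) ⟩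
    p ∧ (𝟎 ∨ b)                    ≈⟨ ∧-distribˡ-∨ p 𝟎 b ⟩
    (p ∧ 𝟎) ∨ (p ∧ b)              ≤⟨ ∨-least (≤-trans ⇒-eval (x∧y≤y a b)) (x∧y≤y p b) ⟩
    b                              ∎)
    where p = 𝟎 ⇒ (a ∧ b)

  ¬⇒∧¬⇒≤⊕ : ∀ a b → (¬ a ⇒ b) ∧ (¬ b ⇒ a) ≤ a ⊕ b
  ¬⇒∧¬⇒≤⊕ a b = ∧-greatest
    (transpose-⇒ (∧-greatest
      (≤-trans (∧-monotonic (x∧y≤y (¬ a ⇒ b) (¬ b ⇒ a)) ≤-refl) ¬⇒∧𝟎≤)
      (≤-trans (∧-monotonic (x∧y≤x (¬ a ⇒ b) (¬ b ⇒ a)) ≤-refl) ¬⇒∧𝟎≤)))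
    (≤-trans (x∧y≤x (¬ a ⇒ b) (¬ b ⇒ a)) ¬⇒≤∨)

mainTheorem17 : ∀ {c ℓ : Level} (B : BooleanPointedBrouwerianAlgebra c ℓ) →
    let open BooleanPointedBrouwerianAlgebra B in
    ∀ a b → (a ⊕ b) ≈ (((¬ a) ⇒ b) ∧ ((¬ b) ⇒ a))
mainTheorem17 B a b = ≤-antisym
  (∧-greatest (⊕≤¬⇒ a b) (≤-trans (≤-reflexive (⊕-comm a b)) (⊕≤¬⇒ b a)))
  (¬⇒∧¬⇒≤⊕ a b)
  where
  open BooleanPointedBrouwerianAlgebraProperties B
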